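{- Let $p$ be a prime, $\alpha\geq 1$ an integer, and $\Gamma=\mathrm{Cay}(\mathbb{Z}_{p}\times\mathbb{Z}_{p^{\alpha}},\Phi)$ with $\Phi=\varphi_p\times\varphi_{p^\alpha}$. Then (1) $\mathrm{diam}(\Gamma)=1$ if $p=2$ and $\alpha=1$; (2) $\mathrm{diam}(\Gamma)=2$ if either $p=2$ and $\alpha\geq 2$, or $p\geq 3$ and $\alpha\geq 1$.
   Context: For $n\geq 1$, $\mathbb{Z}_n=\{0,\dots,n-1\}$ is the integers mod $n$ and $\varphi_n$ is the set of elements of $\mathbb{Z}_n$ coprime to $n$ ($\varphi_p=\mathbb{Z}_p\setminus\{0\}$ for $p$ prime). $\mathrm{Cay}(\mathbb{Z}_p\times\mathbb{Z}_m,\varphi_p\times\varphi_m)$ is the graph on $\mathbb{Z}_p\times\mathbb{Z}_m$ where $(u,v)\sim(u',v')$ iff $u-u'\in\varphi_p$ and $v-v'\in\varphi_m$. The diameter of a disconnected graph is, by convention, the maximum of the diameters of its connected components. -}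

module Defs where

open import Data.Nat using (ℕ; zero; suc; _<_; _≤_; _^_; ∣_-_∣)
open import Data.Nat.Coprimality using (Coprime)
open import Data.Fin using (Fin; toℕ)
open import Data.Product using (_×_; _,_; Σ; ∃; ∃-syntax)
open import Relation.Nullary using (¬_)

-- ℤ_n is represented by Fin n.  For a, b ∈ ℤ_n the residue a - b (mod n)
-- lies in φ_n iff it is coprime to n, iff gcd(|a - b|, n) = 1 (computed
-- on representatives 0 ≤ a, b < n).
InPhi : (n : ℕ) → Fin n → Fin n → Set
InPhi n a b = Coprime ∣ toℕ a - toℕ b ∣ n

Vertex : ℕ → ℕ → Set
Vertex p m = Fin p × Fin m

CayAdj : (p m : ℕ) → Vertex p m → Vertex p m → Set
CayAdj p m (u , v) (u′ , v′) = InPhi p u u′ × InPhi m v v′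

data Walk {V : Set} (Adj : V → V → Set) : V → V → ℕ → Set where
  here : ∀ {x} → Walk Adj x x zero
  step : ∀ {x y z k} → Adj x y → Walk Adj y z k → Walk Adj x z (suc k)

Connected : {V : Set} → (V → V → Set) → V → V → Set
Connected Adj x y = ∃[ k ] Walk Adj x y k

Dist : {V : Set} → (V → V → Set) → V → V → ℕ → Set
Dist Adj x y d = Walk Adj x y d × (∀ k → k < d → ¬ Walk Adj x y k)

-- The diameter is d: the maximum, over all pairs of vertices in a common
-- connected component, of their distance equals d (for a disconnected graph
-- this is the maximum of the diameters of its components).
IsDiameter : {V : Set} → (V → V → Set) → ℕ → Set
IsDiameter {V} Adj d =
  (∀ x y → Connected Adj x y → ∃[ k ] (k ≤ d × Walk Adj x y k))
  × (∃[ x ] ∃[ y ] Dist Adj x y d)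

Γ : (p α : ℕ) → Vertex p (p ^ α) → Vertex p (p ^ α) → Set
Γ p α = CayAdj p (p ^ α)

-- An element of ℤ_{p^α} is a unit iff it is nonzero mod p, so (u , v) ~ (u′ , v′) in Γ iff
-- u ≢ u′ and v ≢ v′ mod p.  For p ≥ 3 some residue avoids any two given ones, so any two
-- vertices have a common neighbour, while vertices with the same first coordinate are never
-- adjacent: the diameter is 2.  For p = 2 every edge flips both parities, so u + v mod 2 is
-- constant on components; two vertices in a component are either adjacent or congruent
-- mod 2 in both coordinates, and then have a common neighbour — unless α = 1, where
-- congruence means equality and the diameter drops to 1.
module Submission where

open import Defs
open import Data.Nat using (ℕ; _≤_; _≥_)
open import Data.Nat.Primality using (Prime)
open import Data.Product using (_×_)
open import Data.Sum using (_⊎_)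
open import Relation.Binary.PropositionalEquality using (_≡_)

open import Data.Nat using (zero; suc; _<_; _+_; _*_; _∸_; _%_; _/_; _^_; ∣_-_∣; NonZero; z≤n; s≤s)
open import Data.Nat.Properties
  using (≤-refl; ≤-total; <-≤-trans; +-suc; *-identityʳ; *-distribʳ-∸; m≤m*n; m^n≢0; ^-monoʳ-≤;
         m+[n∸m]≡n; [m+n]∸[m+o]≡n∸o; ∣n-n∣≡0; ∣m-n∣≡[m∸n]∨[n∸m]; m≤n⇒∣m-n∣≡n∸m; m≤n⇒∣n-m∣≡n∸m)
open import Data.Nat.Divisibility using (_∣_; divides; ∣-trans; ∣1⇒≡1; m∣m*n)
open import Data.Nat.DivMod using (m≡m%n+[m/n]*n; %-remove-+ʳ; %-distribˡ-+; m<n⇒m%n≡m; m%n<n)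
open import Data.Nat.Coprimality using (Coprime; coprime-divisor; ¬0-coprimeTo-2+)
open import Data.Nat.Primality
  using (prime⇒irreducible; prime⇒nonZero; prime⇒nonTrivial; ¬prime[1]; prime[2])
open import Data.Fin using (Fin; toℕ; fromℕ<)
open import Data.Fin.Patterns using (0F; 1F)
open import Data.Fin.Properties using (toℕ-injective; toℕ<n; toℕ-fromℕ<)
open import Data.Product using (_,_; proj₂; ∃-syntax)
open import Data.Product.Function.NonDependent.Propositional using (_×-⇔_)
open import Data.Sum using (inj₁; inj₂; map₁)
open import Function using (_∘_)
open import Function.Bundles using (_⇔_; mk⇔; Equivalence)
open import Relation.Nullary using (¬_; contradiction)
open import Relation.Binary.PropositionalEquality
  using (_≢_; refl; sym; trans; cong; cong₂; subst; module ≡-Reasoning)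

open Equivalence using (to; from)
open ≡-Reasoning

private
  variable
    p m n k : ℕ

%≡⇒∣∸ : ∀ d .{{_ : NonZero d}} a b → a % d ≡ b % d → d ∣ a ∸ b
%≡⇒∣∸ d a b eq = divides (a / d ∸ b / d) (begin
  a ∸ b
    ≡⟨ cong₂ _∸_ (m≡m%n+[m/n]*n a d) (m≡m%n+[m/n]*n b d) ⟩
  (a % d + a / d * d) ∸ (b % d + b / d * d)
    ≡⟨ cong (λ r → (a % d + a / d * d) ∸ (r + b / d * d)) eq ⟨
  (a % d + a / d * d) ∸ (a % d + b / d * d)
    ≡⟨ [m+n]∸[m+o]≡n∸o (a % d) _ _ ⟩
  a / d * d ∸ b / d * d
    ≡⟨ *-distribʳ-∸ d (a / d) (b / d) ⟨
  (a / d ∸ b / d) * d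
    ∎)

∣∸⇒%≡ : ∀ d .{{_ : NonZero d}} {a b} → b ≤ a → d ∣ a ∸ b → a % d ≡ b % d
∣∸⇒%≡ d {a} {b} b≤a d∣a∸b = begin
  a % d             ≡⟨ cong (_% d) (m+[n∸m]≡n b≤a) ⟨
  (b + (a ∸ b)) % d ≡⟨ %-remove-+ʳ b d∣a∸b ⟩
  b % d             ∎

∣∣m-n∣⇔%≡ : ∀ d .{{_ : NonZero d}} a b → d ∣ ∣ a - b ∣ ⇔ a % d ≡ b % d
∣∣m-n∣⇔%≡ d a b = mk⇔ ∣⇒%≡ %≡⇒∣
  where
  ∣⇒%≡ : d ∣ ∣ a - b ∣ → a % d ≡ b % d
  ∣⇒%≡ d∣ with ≤-total a b
  ... | inj₁ a≤b = sym (∣∸⇒%≡ d a≤b (subst (d ∣_) (m≤n⇒∣m-n∣≡n∸m a≤b) d∣))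
  ... | inj₂ b≤a = ∣∸⇒%≡ d b≤a (subst (d ∣_) (m≤n⇒∣n-m∣≡n∸m b≤a) d∣)
  %≡⇒∣ : a % d ≡ b % d → d ∣ ∣ a - b ∣
  %≡⇒∣ eq with ∣m-n∣≡[m∸n]∨[n∸m] a b
  ... | inj₁ e = subst (d ∣_) (sym e) (%≡⇒∣∸ d a b eq)
  ... | inj₂ e = subst (d ∣_) (sym e) (%≡⇒∣∸ d b a (sym eq))

+-cong-% : ∀ d .{{_ : NonZero d}} a a′ b b′ → a % d ≡ a′ % d → b % d ≡ b′ % d →
           (a + b) % d ≡ (a′ + b′) % d
+-cong-% d a a′ b b′ ea eb = begin
  (a + b) % d           ≡⟨ %-distribˡ-+ a b d ⟩
  (a % d + b % d) % d   ≡⟨ cong₂ (λ x y → (x + y) % d) ea eb ⟩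
  (a′ % d + b′ % d) % d ≡⟨ %-distribˡ-+ a′ b′ d ⟨
  (a′ + b′) % d         ∎

m≤m^[1+n] : ∀ m n .{{_ : NonZero m}} → m ≤ m ^ suc n
m≤m^[1+n] m n = m≤m*n m (m ^ n) {{m^n≢0 m n}}

fromℕ<-≢ : ∀ {i j} (i<n : i < n) (j<n : j < n) → i ≢ j →
           toℕ (fromℕ< i<n) ≢ toℕ (fromℕ< j<n)
fromℕ<-≢ i<n j<n i≢j e = i≢j (trans (sym (toℕ-fromℕ< i<n)) (trans e (toℕ-fromℕ< j<n)))

%-injective-Fin : .{{_ : NonZero n}} (a b : Fin n) → toℕ a % n ≡ toℕ b % n → a ≡ b
%-injective-Fin a b eq = toℕ-injective (begin
  toℕ a     ≡⟨ m<n⇒m%n≡m (toℕ<n a) ⟨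
  toℕ a % _ ≡⟨ eq ⟩
  toℕ b % _ ≡⟨ m<n⇒m%n≡m (toℕ<n b) ⟩
  toℕ b     ∎)

%2-dichotomy : ∀ a b → a % 2 ≡ b % 2 ⊎ suc a % 2 ≡ b % 2
%2-dichotomy 0 0 = inj₁ refl
%2-dichotomy 0 1 = inj₂ refl
%2-dichotomy 1 0 = inj₂ refl
%2-dichotomy 1 1 = inj₁ refl
%2-dichotomy (suc (suc a)) b = %2-dichotomy a b
%2-dichotomy a (suc (suc b)) = %2-dichotomy a b

suc-%2≢ : ∀ a → suc a % 2 ≢ a % 2
suc-%2≢ 0 ()
suc-%2≢ 1 ()
suc-%2≢ (suc (suc a)) = suc-%2≢ a

%2≢⇒suc-%2≡ : ∀ a b → a % 2 ≢ b % 2 → suc a % 2 ≡ b % 2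
%2≢⇒suc-%2≡ a b a≢b with %2-dichotomy a b
... | inj₁ a≡b  = contradiction a≡b a≢b
... | inj₂ sa≡b = sa≡b

%2≢-both⇒sum-%2≡ : ∀ a a′ b b′ → a % 2 ≢ a′ % 2 → b % 2 ≢ b′ % 2 →
                   (a + b) % 2 ≡ (a′ + b′) % 2
%2≢-both⇒sum-%2≡ a a′ b b′ a≢a′ b≢b′ = begin
  (a + b) % 2         ≡⟨ cong (λ s → suc s % 2) (+-suc a b) ⟨
  (suc a + suc b) % 2 ≡⟨ +-cong-% 2 (suc a) a′ (suc b) b′
                           (%2≢⇒suc-%2≡ a a′ a≢a′) (%2≢⇒suc-%2≡ b b′ b≢b′) ⟩
  (a′ + b′) % 2       ∎

sum-%2≡⇒%2-both-≢⊎≡ : ∀ a a′ b b′ → (a + b) % 2 ≡ (a′ + b′) % 2 →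
  (a % 2 ≢ a′ % 2 × b % 2 ≢ b′ % 2) ⊎ (a % 2 ≡ a′ % 2 × b % 2 ≡ b′ % 2)
sum-%2≡⇒%2-both-≢⊎≡ a a′ b b′ eq with %2-dichotomy a a′ | %2-dichotomy b b′
... | inj₁ a≡a′ | inj₁ b≡b′ = inj₂ (a≡a′ , b≡b′)
... | inj₂ sa≡a′ | inj₂ sb≡b′ =
  inj₁ (suc-%2≢ a ∘ trans sa≡a′ ∘ sym , suc-%2≢ b ∘ trans sb≡b′ ∘ sym)
... | inj₁ a≡a′ | inj₂ sb≡b′ = contradiction (begin
  suc (a + b) % 2 ≡⟨ cong (_% 2) (+-suc a b) ⟨
  (a + suc b) % 2 ≡⟨ +-cong-% 2 a a′ (suc b) b′ a≡a′ sb≡b′ ⟩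
  (a′ + b′) % 2   ≡⟨ eq ⟨
  (a + b) % 2     ∎) (suc-%2≢ (a + b))
... | inj₂ sa≡a′ | inj₁ b≡b′ = contradiction (begin
  (suc a + b) % 2 ≡⟨ +-cong-% 2 (suc a) a′ b b′ sa≡a′ b≡b′ ⟩
  (a′ + b′) % 2   ≡⟨ eq ⟨
  (a + b) % 2     ∎) (suc-%2≢ (a + b))

_IsRadicalOf_ : ℕ → ℕ → Set
p IsRadicalOf m = ∀ n → Coprime n m ⇔ (¬ p ∣ n)

¬∣⇒coprime : Prime p → ¬ p ∣ n → Coprime n p
¬∣⇒coprime pp p∤n (d∣n , d∣p) with prime⇒irreducible pp d∣p
... | inj₁ d≡1  = d≡1
... | inj₂ refl = contradiction d∣n p∤n

¬∣⇒coprime-^ : Prime p → ¬ p ∣ n → ∀ k → Coprime n (p ^ k)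
¬∣⇒coprime-^ pp p∤n zero    (_ , d∣1)       = ∣1⇒≡1 d∣1
¬∣⇒coprime-^ pp p∤n (suc k) (d∣n , d∣p*p^k) =
  ¬∣⇒coprime-^ pp p∤n k (d∣n , coprime-divisor d⊥p d∣p*p^k)
  where d⊥p = ¬∣⇒coprime pp (λ p∣d → p∤n (∣-trans p∣d d∣n))

coprime-^⇒¬∣ : Prime p → Coprime n (p ^ suc k) → ¬ p ∣ n
coprime-^⇒¬∣ {p} {k = k} pp c p∣n = ¬prime[1] (subst Prime (c (p∣n , m∣m*n (p ^ k))) pp)

prime⇒isRadicalOf-^ : Prime p → p IsRadicalOf (p ^ suc k)
prime⇒isRadicalOf-^ {k = k} pp n =
  mk⇔ (coprime-^⇒¬∣ {n = n} {k = k} pp) (λ p∤n → ¬∣⇒coprime-^ pp p∤n (suc k))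

prime⇒isRadicalOf-self : Prime p → p IsRadicalOf p
prime⇒isRadicalOf-self {p} pp =
  subst (p IsRadicalOf_) (*-identityʳ p) (prime⇒isRadicalOf-^ {k = 0} pp)

InPhi⇔%≢ : .{{_ : NonZero p}} → p IsRadicalOf m → (a b : Fin m) →
           InPhi m a b ⇔ (toℕ a % p ≢ toℕ b % p)
InPhi⇔%≢ {p} rad a b = mk⇔
  (λ (c : InPhi _ a b) eq → to rad′ c (from ∣⇔%≡ eq))
  (λ a≢b → from rad′ (a≢b ∘ to ∣⇔%≡))
  where
  rad′ = rad ∣ toℕ a - toℕ b ∣
  ∣⇔%≡ = ∣∣m-n∣⇔%≡ p (toℕ a) (toℕ b)

record ResidueAvoiding (p : ℕ) .{{_ : NonZero p}} (a b : ℕ) : Set where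
  constructor avoiding
  field
    residue   : ℕ
    residue<p : residue < p
    residue≢a : residue ≢ a % p
    residue≢b : residue ≢ b % p

avoid-two : ∀ a b → ∃[ c ] (c < 3 × c ≢ a × c ≢ b)
avoid-two 0             0             = 1 , s≤s (s≤s z≤n) , (λ ()) , (λ ())
avoid-two 0             1             = 2 , ≤-refl , (λ ()) , (λ ())
avoid-two 0             (suc (suc b)) = 1 , s≤s (s≤s z≤n) , (λ ()) , (λ ())
avoid-two 1             0             = 2 , ≤-refl , (λ ()) , (λ ())
avoid-two 1             (suc b)       = 0 , s≤s z≤n , (λ ()) , (λ ())
avoid-two (suc (suc a)) 0             = 1 , s≤s (s≤s z≤n) , (λ ()) , (λ ())
avoid-two (suc (suc a)) (suc b)       = 0 , s≤s z≤n , (λ ()) , (λ ())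

residueAvoiding-3≤ : .{{_ : NonZero p}} → 3 ≤ p → ∀ a b → ResidueAvoiding p a b
residueAvoiding-3≤ {p} 3≤p a b with avoid-two (a % p) (b % p)
... | c , c<3 , c≢a , c≢b = avoiding c (<-≤-trans c<3 3≤p) c≢a c≢b

residueAvoiding-%2≡ : ∀ {a b} → a % 2 ≡ b % 2 → ResidueAvoiding 2 a b
residueAvoiding-%2≡ {a} a≡b =
  avoiding (suc a % 2) (m%n<n (suc a) 2) (suc-%2≢ a) (suc-%2≢ a ∘ (λ e → trans e (sym a≡b)))

common-neighbour : .{{_ : NonZero p}} → p IsRadicalOf m → p ≤ m → (a b : Fin m) →
                   ResidueAvoiding p (toℕ a) (toℕ b) → ∃[ z ] (InPhi m a z × InPhi m z b)
common-neighbour {p} rad p≤m a b (avoiding c c<p c≢a c≢b) =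
  z , from (InPhi⇔%≢ rad a z) (λ e → c≢a (sym (trans e z%p)))
    , from (InPhi⇔%≢ rad z b) (λ e → c≢b (trans (sym z%p) e))
  where
  c<m = <-≤-trans c<p p≤m
  z   = fromℕ< c<m
  z%p : toℕ z % p ≡ c
  z%p = trans (cong (_% p) (toℕ-fromℕ< c<m)) (m<n⇒m%n≡m c<p)

module _ {V : Set} {Adj : V → V → Set} where

  walk-invariant : ∀ {A : Set} (J : V → A) → (∀ {x y} → Adj x y → J x ≡ J y) →
                   ∀ {x y k} → Walk Adj x y k → J x ≡ J y
  walk-invariant J inv here       = refl
  walk-invariant J inv (step a w) = trans (inv a) (walk-invariant J inv w)

  dist-1 : ∀ {x y} → x ≢ y → Adj x y → Dist Adj x y 1
  dist-1 x≢y adj = step adj here , λ { zero _ here → x≢y refl ; (suc _) (s≤s ()) }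

  dist-2 : ∀ {x y} → x ≢ y → ¬ Adj x y → Walk Adj x y 2 → Dist Adj x y 2
  dist-2 x≢y ¬adj w = w , shorter
    where
    shorter : ∀ k → k < 2 → ¬ Walk Adj _ _ k
    shorter zero          _ here            = x≢y refl
    shorter (suc zero)    _ (step adj here) = ¬adj adj
    shorter (suc (suc _)) (s≤s (s≤s ()))

walk₂ : .{{_ : NonZero p}} → Prime p → ∀ k {u u′ : Fin p} {v v′ : Fin (p ^ suc k)} →
        ResidueAvoiding p (toℕ u) (toℕ u′) → ResidueAvoiding p (toℕ v) (toℕ v′) →
        Walk (Γ p (suc k)) (u , v) (u′ , v′) 2
walk₂ {p} pp k ru rv
  with common-neighbour (prime⇒isRadicalOf-self pp) ≤-refl _ _ ru
     | common-neighbour (prime⇒isRadicalOf-^ {k = k} pp) (m≤m^[1+n] p k) _ _ rv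
... | w , uw , wu′ | z , vz , zv′ = step (uw , vz) (step (wu′ , zv′) here)

¬Γ-same-fst : Prime p → ∀ α {u : Fin p} {v v′ : Fin (p ^ α)} → ¬ Γ p α (u , v) (u , v′)
¬Γ-same-fst {p} pp α {u} (u⊥u , _) =
  ¬0-coprimeTo-2+ (subst (λ d → Coprime d p) (∣n-n∣≡0 (toℕ u)) u⊥u)
  where instance _ = prime⇒nonTrivial pp

dist₂-same-fst : Prime p → ∀ α {u : Fin p} {v v′ : Fin (p ^ α)} → toℕ v ≢ toℕ v′ →
                 Walk (Γ p α) (u , v) (u , v′) 2 → Dist (Γ p α) (u , v) (u , v′) 2
dist₂-same-fst {p} pp α {u} {v} {v′} v≢v′ =
  dist-2 (v≢v′ ∘ cong (λ (x : Vertex p (p ^ α)) → toℕ (proj₂ x))) (¬Γ-same-fst pp α {u} {v} {v′})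

Γ-adj⇔%≢ : .{{_ : NonZero p}} → Prime p → ∀ k (u u′ : Fin p) (v v′ : Fin (p ^ suc k)) →
           Γ p (suc k) (u , v) (u′ , v′) ⇔ (toℕ u % p ≢ toℕ u′ % p × toℕ v % p ≢ toℕ v′ % p)
Γ-adj⇔%≢ pp k u u′ v v′ =
  InPhi⇔%≢ (prime⇒isRadicalOf-self pp) u u′ ×-⇔ InPhi⇔%≢ (prime⇒isRadicalOf-^ {k = k} pp) v v′

parity : Vertex 2 m → ℕ
parity (u , v) = (toℕ u + toℕ v) % 2

parity-invariant : ∀ k {x y} → Γ 2 (suc k) x y → parity x ≡ parity y
parity-invariant k {u , v} {u′ , v′} adj =
  let u≢u′ , v≢v′ = to (Γ-adj⇔%≢ prime[2] k u u′ v v′) adj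
  in  %2≢-both⇒sum-%2≡ (toℕ u) (toℕ u′) (toℕ v) (toℕ v′) u≢u′ v≢v′

same-parity⇒adj⊎same-residues : ∀ k (u u′ : Fin 2) (v v′ : Fin (2 ^ suc k)) →
  parity (u , v) ≡ parity (u′ , v′) →
  Γ 2 (suc k) (u , v) (u′ , v′) ⊎ (toℕ u % 2 ≡ toℕ u′ % 2 × toℕ v % 2 ≡ toℕ v′ % 2)
same-parity⇒adj⊎same-residues k u u′ v v′ eq =
  map₁ (from (Γ-adj⇔%≢ prime[2] k u u′ v v′))
       (sum-%2≡⇒%2-both-≢⊎≡ (toℕ u) (toℕ u′) (toℕ v) (toℕ v′) eq)

connected⇒same-parity : ∀ k {x y} → Connected (Γ 2 (suc k)) x y → parity x ≡ parity y
connected⇒same-parity k (_ , w) =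
  walk-invariant {Adj = Γ 2 (suc k)} parity (λ {x} {y} → parity-invariant k {x} {y}) w

Γ[2,1]-diameter-1 : IsDiameter (Γ 2 1) 1
Γ[2,1]-diameter-1 =
  within-1 , (0F , 0F) , (1F , 1F) ,
  dist-1 (λ ()) (from (Γ-adj⇔%≢ prime[2] 0 0F 1F 0F 1F) ((λ ()) , (λ ())))
  where
  within-1 : ∀ x y → Connected (Γ 2 1) x y → ∃[ j ] (j ≤ 1 × Walk (Γ 2 1) x y j)
  within-1 (u , v) (u′ , v′) c
    with same-parity⇒adj⊎same-residues 0 u u′ v v′ (connected⇒same-parity 0 c)
  ... | inj₁ adj = 1 , ≤-refl , step adj here
  ... | inj₂ (u≡u′ , v≡v′)
    rewrite %-injective-Fin u u′ u≡u′ | %-injective-Fin v v′ v≡v′ = 0 , z≤n , here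

Γ[2,2+k]-diameter-2 : ∀ k → IsDiameter (Γ 2 (2 + k)) 2
Γ[2,2+k]-diameter-2 k =
  within-2 , (0F , v₀) , (0F , v₂) ,
  dist₂-same-fst prime[2] (2 + k) (fromℕ<-≢ 0<m 2<m λ ())
    (walk₂ prime[2] (suc k) (residueAvoiding-%2≡ refl) (residueAvoiding-%2≡ v₀≡v₂[2]))
  where
  within-2 : ∀ x y → Connected (Γ 2 (2 + k)) x y → ∃[ j ] (j ≤ 2 × Walk (Γ 2 (2 + k)) x y j)
  within-2 (u , v) (u′ , v′) c
    with same-parity⇒adj⊎same-residues (suc k) u u′ v v′ (connected⇒same-parity (suc k) c)
  ... | inj₁ adj = 1 , s≤s z≤n , step adj here
  ... | inj₂ (u≡u′ , v≡v′) =
    2 , ≤-refl , walk₂ prime[2] (suc k) (residueAvoiding-%2≡ u≡u′) (residueAvoiding-%2≡ v≡v′)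
  2<m : 2 < 2 ^ (2 + k)
  2<m = <-≤-trans (s≤s (s≤s (s≤s z≤n))) (^-monoʳ-≤ 2 {2} {2 + k} (s≤s (s≤s z≤n)))
  0<m = <-≤-trans (s≤s z≤n) 2<m
  v₀ = fromℕ< 0<m
  v₂ = fromℕ< 2<m
  v₀≡v₂[2] : toℕ v₀ % 2 ≡ toℕ v₂ % 2
  v₀≡v₂[2] = trans (cong (_% 2) (toℕ-fromℕ< 0<m)) (sym (cong (_% 2) (toℕ-fromℕ< 2<m)))

Γ[p≥3]-diameter-2 : ∀ k → Prime p → 3 ≤ p → IsDiameter (Γ p (suc k)) 2
Γ[p≥3]-diameter-2 {p} k pp 3≤p =
  (λ x y _ → 2 , ≤-refl , any-walk₂ x y) , (u₀ , v₀) , (u₀ , v₁) ,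
  dist₂-same-fst pp (suc k) (fromℕ<-≢ 0<m 1<m λ ()) (any-walk₂ _ _)
  where
  instance _ = prime⇒nonZero pp
  any-walk₂ : ∀ x y → Walk (Γ p (suc k)) x y 2
  any-walk₂ _ _ = walk₂ pp k (residueAvoiding-3≤ 3≤p _ _) (residueAvoiding-3≤ 3≤p _ _)
  1<m : 1 < p ^ suc k
  1<m = <-≤-trans (<-≤-trans (s≤s (s≤s z≤n)) 3≤p) (m≤m^[1+n] p k)
  0<m = <-≤-trans (s≤s z≤n) 1<m
  u₀ = fromℕ< {0} {p} (<-≤-trans (s≤s z≤n) 3≤p)
  v₀ = fromℕ< 0<m
  v₁ = fromℕ< 1<m

theorem2p1 : (p α : ℕ) → Prime p → 1 ≤ α →
    ((p ≡ 2 × α ≡ 1) → IsDiameter (Γ p α) 1)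
    × (((p ≡ 2 × α ≥ 2) ⊎ (p ≥ 3 × α ≥ 1)) → IsDiameter (Γ p α) 2)
theorem2p1 p α pp _ = diameter-1 , diameter-2
  where
  diameter-1 : (p ≡ 2 × α ≡ 1) → IsDiameter (Γ p α) 1
  diameter-1 (refl , refl) = Γ[2,1]-diameter-1
  diameter-2 : ((p ≡ 2 × α ≥ 2) ⊎ (p ≥ 3 × α ≥ 1)) → IsDiameter (Γ p α) 2
  diameter-2 (inj₁ (refl , s≤s (s≤s {n = k} _))) = Γ[2,2+k]-diameter-2 k
  diameter-2 (inj₂ (3≤p , s≤s {n = k} _))          = Γ[p≥3]-diameter-2 k pp 3≤p
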